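{- Let $\rho,n\ge1$. Any deterministic LOCAL algorithm which, on every $n$-vertex graph, outputs a matching whose size is at least $1/\rho$ times the maximum matching size requires $\Omega\!\left(\frac{\log^* n}{\rho}\right)$ rounds.
   Context: The LOCAL model: synchronous rounds, unbounded computation and message sizes, each vertex has a unique ID of $\Theta(\log n)$ bits. $\log^*$ is the iterated logarithm.
   Formalization: The approximation ratio ρ ranges over the rationals at least 1. -}

module Defs where

open import Data.Nat using (ℕ; zero; suc; _+_; _*_; _^_; _≤_; _<_; _<ᵇ_; _≤ᵇ_)
open import Data.Nat.Logarithm using (⌊log₂_⌋)
open import Data.Bool using (Bool; true; false; if_then_else_)
open import Data.Fin using (Fin)
open import Data.List using (List; []; _∷_; map; length; filterᵇ; allFin)
open import Data.Maybe using (Maybe; just; nothing)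
open import Data.Product using (Σ; _×_)
open import Relation.Binary.PropositionalEquality using (_≡_)

-- Iterated logarithm: log* m = number of applications of ⌊log₂⌋ needed
-- to bring m down to ≤ 1.  (Fuel m suffices since ⌊log₂ m⌋ < m for m ≥ 2.)
logStarFuel : ℕ → ℕ → ℕ
logStarFuel zero    m = zero
logStarFuel (suc f) m = if m ≤ᵇ 1 then zero else suc (logStarFuel f ⌊log₂ m ⌋)

logStar : ℕ → ℕ
logStar m = logStarFuel m m

record Graph (n : ℕ) : Set where
  field
    adj   : Fin n → Fin n → Bool
    sym   : ∀ u v → adj u v ≡ adj v u
    irrefl : ∀ u → adj u u ≡ false

open Graph public

Adj : ∀ {n} → Graph n → Fin n → Fin n → Set
Adj G u v = adj G u v ≡ true

-- Neighbours of a vertex (listed in vertex order; this plays the role of a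
-- port numbering chosen by the adversary).
neighbours : ∀ {n} → Graph n → Fin n → List (Fin n)
neighbours {n} G u = filterᵇ (adj G u) (allFin n)

endpoints : ∀ {n} → List (Fin n × Fin n) → List (Fin n)
endpoints [] = []
endpoints ((u Data.Product., v) ∷ es) = u ∷ v ∷ endpoints es

open import Data.List.Relation.Unary.All using (All)
open import Data.List.Relation.Unary.Unique.Propositional using (Unique)

IsMatching : ∀ {n} → Graph n → List (Fin n × Fin n) → Set
IsMatching G M =
  All (λ e → Adj G (Data.Product.proj₁ e) (Data.Product.proj₂ e)) M
  × Unique (endpoints M)

record IdAssignment (n c : ℕ) : Set where
  field
    ident : Fin n → ℕ
    injective : ∀ u v → ident u ≡ ident v → u ≡ v
    bounded : ∀ u → ident u < n ^ c

open IdAssignment public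

-- A deterministic LOCAL algorithm (for a fixed n, which it may thus know):
-- arbitrary local state (unbounded computation / message size), initial
-- state determined by the vertex ID, in each synchronous round every vertex
-- receives the full states of all its neighbours and updates its state.
-- After the last round a vertex outputs either nothing (unmatched) or the ID
-- of its claimed mate.
record Algorithm : Set₁ where
  field
    State  : Set
    init   : ℕ → State
    step   : State → List State → State
    output : State → Maybe ℕ

open Algorithm public

run : ∀ {n c} (A : Algorithm) (G : Graph n) (I : IdAssignment n c) →
      ℕ → Fin n → State A
run A G I zero    u = init A (ident I u)
run A G I (suc r) u = step A (run A G I r u) (map (run A G I r) (neighbours G u))

out : ∀ {n c} (A : Algorithm) (G : Graph n) (I : IdAssignment n c) →
      ℕ → Fin n → Maybe ℕ
out A G I T u = output A (run A G I T u)

OutputIsMatching : ∀ {n c} (A : Algorithm) (G : Graph n)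
                   (I : IdAssignment n c) → ℕ → Set
OutputIsMatching {n} A G I T =
  ∀ (u : Fin n) (x : ℕ) → out A G I T u ≡ just x →
  Σ (Fin n) λ v → Adj G u v × ident I v ≡ x × out A G I T v ≡ just (ident I u)

-- Number of edges of the output matching: each edge is counted at its
-- endpoint with the smaller ID.
lowerEnd : ℕ → Maybe ℕ → Bool
lowerEnd i nothing  = false
lowerEnd i (just x) = i <ᵇ x

outputSize : ∀ {n c} (A : Algorithm) (G : Graph n) (I : IdAssignment n c) →
             ℕ → ℕ
outputSize {n} A G I T =
  length (filterᵇ (λ u → lowerEnd (ident I u) (out A G I T u)) (allFin n))

-- A T-round algorithm that, on every n-vertex graph (with every admissible
-- ID assignment), outputs a matching of size at least (1/ρ)·(maximum
-- matching size), where ρ = p / q.  "At least 1/ρ times the maximum" is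
-- expressed as q·|M'| ≤ p·|output| for every matching M' of G.
ApproxMatchingAlgorithm : (c n p q T : ℕ) → Algorithm → Set
ApproxMatchingAlgorithm c n p q T A =
  ∀ (G : Graph n) (I : IdAssignment n c) →
    OutputIsMatching A G I T
    × (∀ (M : List (Fin n × Fin n)) → IsMatching G M →
         q * length M ≤ p * outputSize A G I T)

-- Run a T-round algorithm on a path whose identifiers decrease along it.  A vertex's output
-- depends only on the 2T + 1 identifiers around it, so recording for S consecutive vertices
-- whether each is unmatched, matched forwards, matched backwards or (illegally) elsewhere
-- colours every window of K = 2T + 2 + S identifiers.  Two windows overlapping in all but one
-- identifier get different colours: otherwise S + 1 consecutive vertices have the same kind,
-- and "unmatched" breaks the approximation ratio on a path of 2H = K + 1 vertices (S is chosen
-- of order (p/q)·T), "forwards"/"backwards" breaks the symmetry of the matching, "elsewhere"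
-- breaks adjacency.  This is a proper colouring of the shift graph with 4^S colours, so by
-- Linial's argument n ≤ tower (K - 1) (4^S), i.e. log* n ≤ K + 2S = O((p/q)·T).  With zero
-- rounds the vertex with identifier 0 cannot know its mate, which rules out T = 0 for n ≥ 3.
module Submission where

open import Data.Bool as Bool using (Bool; true; false; _∧_; _∨_; if_then_else_)
open import Data.Bool.Properties using (T-≡; ¬-not; ∨-comm; ∨-identityʳ; ∧-identityʳ; ∧-zeroʳ)
open import Data.Empty using (⊥; ⊥-elim)
open import Data.Fin as Fin using (Fin; toℕ; fromℕ<; funToFin; finToFun; #_)
open import Data.Fin.Properties using (toℕ-injective; toℕ-fromℕ<; toℕ<n; injective⇒≤; finToFun-funToFin)
open import Data.List using (List; []; _∷_; length; map; drop; lookup; filterᵇ; allFin; applyUpTo; _++_)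
open import Data.List.Membership.Propositional using (_∈_; _∉_)
open import Data.List.Membership.Propositional.Properties using (∈-filter⁻; ∈-lookup; ∈-map⁻; ∈-++⁻)
open import Data.List.Properties using (filter-≐; map-cong-local; length-map; length-++; length-applyUpTo)
open import Data.List.Relation.Unary.All as All using (All; []; _∷_)
import Data.List.Relation.Unary.All.Properties as AllP
open import Data.List.Relation.Unary.Any using (here; there; index)
open import Data.List.Relation.Unary.Any.Properties using (lookup-index)
open import Data.List.Relation.Unary.Unique.Propositional using (Unique; []; _∷_)
import Data.List.Relation.Unary.Unique.Propositional.Properties as Unique
open import Data.Maybe using (Maybe; just; nothing)
open import Data.Maybe.Properties using (just-injective)
open import Data.Nat
open import Data.Nat.DivMod using (_/_; _%_; m≡m%n+[m/n]*n; m%n<n; m/n*n≤m)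
open import Data.Nat.Logarithm using (⌊log₂_⌋; ⌊log₂⌋-mono-≤; ⌊log₂[2^n]⌋≡n)
open import Data.Nat.Properties
open import Data.Nat.Tactic.RingSolver using (solve-∀)
open import Data.Product using (Σ; ∃; _×_; _,_; proj₁; proj₂)
open import Data.Sum as Sum using (_⊎_; inj₁; inj₂; [_,_]′)
open import Data.Unit using (⊤; tt)
open import Function using (_∘_; Equivalence; case_of_)
open import Relation.Binary.Definitions using (tri<; tri≈; tri>)
open import Relation.Binary.PropositionalEquality
open import Relation.Nullary using (Dec; yes; no; ¬_; _×-dec_)
open import Relation.Nullary.Decidable using (T?)

open import Defs hiding (sym)

tower : ℕ → ℕ → ℕ
tower zero    l = l
tower (suc k) l = 2 ^ tower k l

tower-2^ : ∀ k l → tower k (2 ^ l) ≡ tower (suc k) l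
tower-2^ zero    l = refl
tower-2^ (suc k) l = cong (2 ^_) (tower-2^ k l)

1+n≤2^n : ∀ n → suc n ≤ 2 ^ n
1+n≤2^n zero    = ≤-refl
1+n≤2^n (suc n) = +-mono-≤ (m^n>0 2 n) (≤-trans (1+n≤2^n n) (≤-reflexive (sym (+-identityʳ _))))

⌊log₂1+n⌋≤n : ∀ n → ⌊log₂ suc n ⌋ ≤ n
⌊log₂1+n⌋≤n n = ≤-trans (⌊log₂⌋-mono-≤ (1+n≤2^n n)) (≤-reflexive (⌊log₂[2^n]⌋≡n n))

logStarFuel-≤ : ∀ f m → logStarFuel f m ≤ m
logStarFuel-≤ zero    m             = z≤n
logStarFuel-≤ (suc f) zero          = z≤n
logStarFuel-≤ (suc f) (suc zero)    = z≤n
logStarFuel-≤ (suc f) (suc (suc m)) = s≤s (≤-trans (logStarFuel-≤ f _) (⌊log₂1+n⌋≤n (suc m)))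

logStarFuel-tower : ∀ f k l m → m ≤ tower k l → logStarFuel f m ≤ k + l
logStarFuel-tower f       zero    l m             m≤ = ≤-trans (logStarFuel-≤ f m) m≤
logStarFuel-tower zero    (suc k) l m             m≤ = z≤n
logStarFuel-tower (suc f) (suc k) l zero          m≤ = z≤n
logStarFuel-tower (suc f) (suc k) l (suc zero)    m≤ = z≤n
logStarFuel-tower (suc f) (suc k) l (suc (suc m)) m≤ = s≤s (logStarFuel-tower f k l _
  (≤-trans (⌊log₂⌋-mono-≤ m≤) (≤-reflexive (⌊log₂[2^n]⌋≡n (tower k l)))))

logStar-tower : ∀ k l m → m ≤ tower k l → logStar m ≤ k + l
logStar-tower k l m = logStarFuel-tower m k l m

-- Linial's bound for colourings of the shift graph

Descending : ℕ → List ℕ → Set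
Descending N []       = ⊤
Descending N (x ∷ xs) = x < N × Descending x xs

descending? : ∀ N xs → Dec (Descending N xs)
descending? N []       = yes tt
descending? N (x ∷ xs) = x <? N ×-dec descending? x xs

dropLast : List ℕ → List ℕ
dropLast []           = []
dropLast (x ∷ [])     = []
dropLast (x ∷ y ∷ xs) = x ∷ dropLast (y ∷ xs)

IsShiftColouring : ∀ {L} (N k : ℕ) → (List ℕ → Fin L) → Set
IsShiftColouring N k χ =
  ∀ z → length z ≡ suc k → Descending N z → χ (drop 1 z) ≢ χ (dropLast z)

indicator : {P : Set} → Dec P → Fin 2
indicator (yes _) = Fin.suc Fin.zero
indicator (no _)  = Fin.zero

indicator-transfer : {P Q : Set} (p : Dec P) (q : Dec Q) → indicator p ≡ indicator q → P → Q
indicator-transfer (yes _) (yes q) _  _ = q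
indicator-transfer (yes _) (no _)  () _
indicator-transfer (no ¬p) _       _  p = ⊥-elim (¬p p)

funToFin-injective : ∀ {m k} {f g : Fin m → Fin k} → funToFin f ≡ funToFin g → ∀ i → f i ≡ g i
funToFin-injective {f = f} {g} eq i =
  trans (sym (finToFun-funToFin f i)) (trans (cong (λ x → finToFun x i) eq) (finToFun-funToFin g i))

module ShiftReduction {N L : ℕ} (χ : List ℕ → Fin L) where

  -- The colour of w in the reduced colouring is the set of colours of its one-step extensions.
  Extends : List ℕ → Fin L → Set
  Extends w c = ∃ λ y → y < N × Descending y w × χ (y ∷ w) ≡ c

  extends? : ∀ w c → Dec (Extends w c)
  extends? w c = anyUpTo? (λ y → descending? y w ×-dec (χ (y ∷ w) Fin.≟ c)) N

  reduced : List ℕ → Fin (2 ^ L)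
  reduced w = funToFin (λ c → indicator (extends? w c))

  reduced-isShiftColouring : ∀ {k} → IsShiftColouring N (suc (suc k)) χ → IsShiftColouring N (suc k) reduced
  reduced-isShiftColouring proper (x ∷ y ∷ r) len (x<N , desc) reduced≡
    with indicator-transfer (extends? (y ∷ r) _) (extends? _ _)
           (funToFin-injective reduced≡ (χ (x ∷ y ∷ r))) (x , x<N , desc , refl)
  ... | y′ , y′<N , (x<y′ , _) , χ≡ = proper (y′ ∷ x ∷ y ∷ r) (cong suc len) (y′<N , x<y′ , desc) (sym χ≡)

singletons-injective : ∀ {N L} (χ : List ℕ → Fin L) → IsShiftColouring N 1 χ →
                       ∀ {i j : Fin N} → χ (toℕ i ∷ []) ≡ χ (toℕ j ∷ []) → i ≡ j
singletons-injective χ proper {i} {j} χ≡ with <-cmp (toℕ i) (toℕ j)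
... | tri< i<j _ _ = ⊥-elim (proper (toℕ j ∷ toℕ i ∷ []) refl (toℕ<n j , i<j , tt) χ≡)
... | tri≈ _ i≡j _ = toℕ-injective i≡j
... | tri> _ _ j<i = ⊥-elim (proper (toℕ i ∷ toℕ j ∷ []) refl (toℕ<n i , j<i , tt) (sym χ≡))

IsShiftColouring⇒≤tower : ∀ {N L} k (χ : List ℕ → Fin L) → IsShiftColouring N (suc k) χ → N ≤ tower k L
IsShiftColouring⇒≤tower zero    χ proper = injective⇒≤ (singletons-injective χ proper)
IsShiftColouring⇒≤tower {N} {L} (suc k) χ proper =
  subst (N ≤_) (tower-2^ k L)
    (IsShiftColouring⇒≤tower k (ShiftReduction.reduced χ) (ShiftReduction.reduced-isShiftColouring χ proper))

-- Out of range, nth returns 0.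
nth : List ℕ → ℕ → ℕ
nth []       _       = 0
nth (x ∷ xs) zero    = x
nth (x ∷ xs) (suc k) = nth xs k

nth-∈ : ∀ xs {k} → k < length xs → nth xs k ∈ xs
nth-∈ (x ∷ xs) {zero}  _        = here refl
nth-∈ (x ∷ xs) {suc k} (s≤s k<) = there (nth-∈ xs k<)

nth-dropLast : ∀ xs {k} → suc k < length xs → nth (dropLast xs) k ≡ nth xs k
nth-dropLast (x ∷ [])     {zero}  (s≤s ())
nth-dropLast (x ∷ y ∷ xs) {zero}  _        = refl
nth-dropLast (x ∷ y ∷ xs) {suc k} (s≤s k<) = nth-dropLast (y ∷ xs) k<

nth-drop1 : ∀ xs k → nth (drop 1 xs) k ≡ nth xs (suc k)
nth-drop1 []       k = refl
nth-drop1 (x ∷ xs) k = refl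

Descending⇒All< : ∀ {N} xs → Descending N xs → All (_< N) xs
Descending⇒All< []       _            = []
Descending⇒All< (x ∷ xs) (x<N , desc) =
  x<N ∷ All.map (λ y<x → <-trans y<x x<N) (Descending⇒All< xs desc)

head∉tail : ∀ {N x} xs → Descending N (x ∷ xs) → x ∉ xs
head∉tail xs (_ , desc) x∈xs = <-irrefl refl (All.lookup (Descending⇒All< xs desc) x∈xs)

nth-descending : ∀ {N} xs → Descending N xs → ∀ {i j} → i < j → j < length xs → nth xs j < nth xs i
nth-descending (x ∷ xs) (_ , desc) {zero}  {suc j} _         (s≤s j<) =
  All.lookup (Descending⇒All< xs desc) (nth-∈ xs j<)
nth-descending (x ∷ xs) (_ , desc) {suc i} {suc j} (s≤s i<j) (s≤s j<) = nth-descending xs desc i<j j<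

nth-<⊎≡0 : ∀ {N} xs → Descending N xs → ∀ k → nth xs k < N ⊎ nth xs k ≡ 0
nth-<⊎≡0 []       _            k       = inj₂ refl
nth-<⊎≡0 (x ∷ xs) (x<N , _)    zero    = inj₁ x<N
nth-<⊎≡0 (x ∷ xs) (x<N , desc) (suc k) = Sum.map₁ (λ y<x → <-trans y<x x<N) (nth-<⊎≡0 xs desc k)

≡ᵇ-refl : ∀ n → (n ≡ᵇ n) ≡ true
≡ᵇ-refl zero    = refl
≡ᵇ-refl (suc n) = ≡ᵇ-refl n

≡ᵇ-sound : ∀ {m n} → (m ≡ᵇ n) ≡ true → m ≡ n
≡ᵇ-sound {m} {n} eq = ≡ᵇ⇒≡ m n (Equivalence.from T-≡ eq)

≢⇒≡ᵇ-false : ∀ {m n} → m ≢ n → (m ≡ᵇ n) ≡ false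
≢⇒≡ᵇ-false m≢n = ¬-not (m≢n ∘ ≡ᵇ-sound)

consecutive : List ℕ → ℕ → ℕ → Bool
consecutive (x ∷ y ∷ xs) a b = ((a ≡ᵇ x) ∧ (b ≡ᵇ y)) ∨ consecutive (y ∷ xs) a b
consecutive _            _ _ = false

consecutive⇒∈ˡ : ∀ x xs {a b} → consecutive (x ∷ xs) a b ≡ true → a ∈ x ∷ xs
consecutive⇒∈ˡ x (y ∷ xs) {a} eq with a ≡ᵇ x in a≡x
... | true  = here (≡ᵇ-sound a≡x)
... | false = there (consecutive⇒∈ˡ y xs eq)

consecutive⇒∈ʳ : ∀ x xs {a b} → consecutive (x ∷ xs) a b ≡ true → b ∈ xs
consecutive⇒∈ʳ x (y ∷ xs) {a} {b} eq with a ≡ᵇ x | b ≡ᵇ y in b≡y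
... | true  | true  = here (≡ᵇ-sound b≡y)
... | true  | false = there (consecutive⇒∈ʳ y xs eq)
... | false | _     = there (consecutive⇒∈ʳ y xs eq)

consecutive⇒∈ : ∀ xs {a b} → consecutive xs a b ≡ true → a ∈ xs × b ∈ xs
consecutive⇒∈ (x ∷ xs) eq = consecutive⇒∈ˡ x xs eq , there (consecutive⇒∈ʳ x xs eq)

consecutive⇒> : ∀ {N} x xs → Descending N (x ∷ xs) → ∀ {a b} → consecutive (x ∷ xs) a b ≡ true → b < a
consecutive⇒> x (y ∷ xs) (_ , desc@(y<x , _)) {a} {b} eq with a ≡ᵇ x in a≡x | b ≡ᵇ y in b≡y
... | true  | true  = subst₂ _<_ (sym (≡ᵇ-sound b≡y)) (sym (≡ᵇ-sound a≡x)) y<x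
... | true  | false = consecutive⇒> y xs desc eq
... | false | _     = consecutive⇒> y xs desc eq

consecutive-irrefl : ∀ {N} xs → Descending N xs → ∀ a → consecutive xs a a ≡ false
consecutive-irrefl []       _    a = refl
consecutive-irrefl (x ∷ xs) desc a = ¬-not (<-irrefl refl ∘ consecutive⇒> x xs desc)

consecutive-after : ∀ {N} xs → Descending N xs → ∀ {k} → suc k < length xs →
                    ∀ b → consecutive xs (nth xs k) b ≡ (b ≡ᵇ nth xs (suc k))
consecutive-after (x ∷ [])     _    {zero} (s≤s ()) _
consecutive-after (x ∷ y ∷ xs) desc {zero} _        b
  rewrite ≡ᵇ-refl x | ¬-not (head∉tail (y ∷ xs) desc ∘ consecutive⇒∈ˡ y xs {x} {b}) =
  ∨-identityʳ _
consecutive-after (x ∷ y ∷ xs) desc@(_ , desc′) {suc k} (s≤s k<) b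
  rewrite ≢⇒≡ᵇ-false {nth (y ∷ xs) k} {x}
            (λ e → head∉tail (y ∷ xs) desc (subst (_∈ y ∷ xs) e (nth-∈ (y ∷ xs) (<-trans (n<1+n k) k<)))) =
  consecutive-after (y ∷ xs) desc′ k< b

consecutive-before : ∀ {N} xs → Descending N xs → ∀ {k} → suc k < length xs →
                     ∀ a → consecutive xs a (nth xs (suc k)) ≡ (a ≡ᵇ nth xs k)
consecutive-before (x ∷ [])     _          {zero} (s≤s ()) _
consecutive-before (x ∷ y ∷ xs) (_ , desc) {zero} _        a
  rewrite ≡ᵇ-refl y | ∧-identityʳ (a ≡ᵇ x) | ¬-not (head∉tail xs desc ∘ consecutive⇒∈ʳ y xs {a} {y}) =
  ∨-identityʳ _
consecutive-before (x ∷ y ∷ xs) (_ , desc) {suc k} (s≤s k<) a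
  rewrite ≢⇒≡ᵇ-false {nth xs k} {y}
            (λ e → head∉tail xs desc (subst (_∈ xs) e (nth-∈ xs (≤-pred k<)))) | ∧-zeroʳ (a ≡ᵇ x) =
  consecutive-before (y ∷ xs) desc k< a

consecutive-pair⇒ : ∀ {a b x y} → consecutive (a ∷ b ∷ []) x y ≡ true → x ≡ a × y ≡ b
consecutive-pair⇒ {a} {b} {x} {y} eq with x ≡ᵇ a in x≡a | y ≡ᵇ b in y≡b
... | true  | true  = ≡ᵇ-sound x≡a , ≡ᵇ-sound y≡b
... | true  | false = case eq of λ ()
... | false | _     = case eq of λ ()

isOneOf : ∀ {n} → ℕ → ℕ → Fin n → Bool
isOneOf a b v = (toℕ v ≡ᵇ a) ∨ (toℕ v ≡ᵇ b)

isOneOf-sound : ∀ {n a b} {v : Fin n} → isOneOf a b v ≡ true → toℕ v ≡ a ⊎ toℕ v ≡ b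
isOneOf-sound {a = a} {v = v} eq with toℕ v ≡ᵇ a in v≡a
... | true  = inj₁ (≡ᵇ-sound v≡a)
... | false = inj₂ (≡ᵇ-sound eq)

filterᵇ-cong : ∀ {A : Set} {p q : A → Bool} → (∀ x → p x ≡ q x) → ∀ xs → filterᵇ p xs ≡ filterᵇ q xs
filterᵇ-cong {p = p} {q} p≡q =
  filter-≐ (T? ∘ p) (T? ∘ q) ((λ {x} → subst Bool.T (p≡q x)) , (λ {x} → subst Bool.T (sym (p≡q x))))

toℕ<n^c : ∀ {n c} → 1 ≤ c → (u : Fin n) → toℕ u < n ^ c
toℕ<n^c {suc n} 1≤c u =
  <-≤-trans (toℕ<n u) (≤-trans (≤-reflexive (sym (^-identityʳ (suc n)))) (^-monoʳ-≤ (suc n) 1≤c))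

toℕ-idAssignment : ∀ {n c} → 1 ≤ c → IdAssignment n c
toℕ-idAssignment 1≤c = record
  { ident     = toℕ
  ; injective = λ _ _ → toℕ-injective
  ; bounded   = toℕ<n^c 1≤c
  }

module PathGraph {n : ℕ} (z : List ℕ) (desc : Descending n z) where

  adjacent : Fin n → Fin n → Bool
  adjacent u v = consecutive z (toℕ u) (toℕ v) ∨ consecutive z (toℕ v) (toℕ u)

  pathGraph : Graph n
  pathGraph = record
    { adj    = adjacent
    ; sym    = λ u v → ∨-comm (consecutive z (toℕ u) (toℕ v)) _
    ; irrefl = λ u → cong₂ _∨_ (consecutive-irrefl z desc (toℕ u)) (consecutive-irrefl z desc (toℕ u))
    }

  adjacent-consecutive : ∀ {k u v} → suc k < length z → toℕ u ≡ nth z k → toℕ v ≡ nth z (suc k) →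
                         Adj pathGraph u v
  adjacent-consecutive {k} k< u≡ v≡
    rewrite u≡ | v≡ | consecutive-after z desc k< (nth z (suc k)) | ≡ᵇ-refl (nth z (suc k)) = refl

  adjacent⇒∈ : ∀ {u v} → Adj pathGraph u v → toℕ u ∈ z
  adjacent⇒∈ {u} {v} uv with consecutive z (toℕ u) (toℕ v) in u→v
  ... | true  = proj₁ (consecutive⇒∈ z u→v)
  ... | false = proj₂ (consecutive⇒∈ z uv)

  adjacent-window : ∀ r {o w u} → w ≗ nth z ∘ (_+ o) → suc (suc r) + o < length z →
                    toℕ u ≡ w (suc r) → ∀ v → adjacent u v ≡ isOneOf (w (suc (suc r))) (w r) v
  adjacent-window r w≗ r+o< u≡ v rewrite u≡ | w≗ (suc r) | w≗ (suc (suc r)) | w≗ r =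
    cong₂ _∨_ (consecutive-after z desc r+o< (toℕ v))
              (consecutive-before z desc (<-trans (n<1+n _) r+o<) (toℕ v))

  neighbours-window : ∀ r {o w u} → w ≗ nth z ∘ (_+ o) → suc (suc r) + o < length z →
                      toℕ u ≡ w (suc r) →
                      neighbours pathGraph u ≡ filterᵇ (isOneOf (w (suc (suc r))) (w r)) (allFin n)
  neighbours-window r w≗ r+o< u≡ = filterᵇ-cong (adjacent-window r w≗ r+o< u≡) (allFin n)

pairs : ∀ {A : Set} → (ℕ → A) → ℕ → List (A × A)
pairs f zero    = []
pairs f (suc m) = (f 0 , f 1) ∷ pairs (f ∘ suc ∘ suc) m

length-pairs : ∀ {A : Set} (f : ℕ → A) m → length (pairs f m) ≡ m
length-pairs f zero    = refl
length-pairs f (suc m) = cong suc (length-pairs (f ∘ suc ∘ suc) m)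

endpoints-pairs : ∀ {n} (f : ℕ → Fin n) m → endpoints (pairs f m) ≡ applyUpTo f (m + m)
endpoints-pairs f zero    = refl
endpoints-pairs f (suc m) rewrite +-suc m m = cong (λ xs → f 0 ∷ f 1 ∷ xs) (endpoints-pairs (f ∘ suc ∘ suc) m)

pairs-All : ∀ {A : Set} {P : A × A → Set} (f : ℕ → A) m →
            (∀ {k} → suc k < m + m → P (f k , f (suc k))) → All P (pairs f m)
pairs-All f zero    _      = []
pairs-All f (suc m) linked rewrite +-suc m m =
  linked (s≤s (s≤s z≤n)) ∷ pairs-All (f ∘ suc ∘ suc) m (λ k< → linked (s≤s (s≤s k<)))

-- Locality of LOCAL algorithms on paths

window-suc : ∀ z {o w} → w ≗ nth z ∘ (_+ o) → w ∘ suc ≗ nth z ∘ (_+ suc o)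
window-suc z {o} w≗ i = trans (w≗ (suc i)) (cong (nth z) (sym (+-suc i o)))

module Locality {n : ℕ} (A : Algorithm) where

  neighbourStates : ℕ → ℕ → State A → State A → List (State A)
  neighbourStates a b sa sb =
    map (λ v → if toℕ v ≡ᵇ a then sa else sb) (filterᵇ (isOneOf a b) (allFin n))

  -- The state after r rounds of the centre w r of a path segment with identifiers w 0, …, w (2r).
  windowState : ℕ → (ℕ → ℕ) → State A
  windowState zero    w = init A (w 0)
  windowState (suc r) w =
    step A (windowState r (w ∘ suc))
           (neighbourStates (w (suc (suc r))) (w r) (windowState r (w ∘ suc ∘ suc)) (windowState r w))

  neighbourStates-cong : ∀ {a a′ b b′ sa sa′ sb sb′} → a ≡ a′ → b ≡ b′ → sa ≡ sa′ → sb ≡ sb′ →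
                         neighbourStates a b sa sb ≡ neighbourStates a′ b′ sa′ sb′
  neighbourStates-cong refl refl refl refl = refl

  windowState-cong : ∀ r {w w′} → (∀ {i} → i ≤ r + r → w i ≡ w′ i) → windowState r w ≡ windowState r w′
  windowState-cong zero    agree = cong (init A) (agree z≤n)
  windowState-cong (suc r) {w} {w′} agree =
    cong₂ (step A)
      (windowState-cong r (λ i≤ → within (m≤n⇒m≤1+n (s≤s i≤))))
      (neighbourStates-cong (within (s≤s (s≤s (m≤m+n r r)))) (within (m≤n⇒m≤1+n (m≤n⇒m≤1+n (m≤m+n r r))))
        (windowState-cong r (λ i≤ → within (s≤s (s≤s i≤))))
        (windowState-cong r (λ i≤ → within (m≤n⇒m≤1+n (m≤n⇒m≤1+n i≤)))))
    where
    within : ∀ {i} → i ≤ suc (suc (r + r)) → w i ≡ w′ i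
    within i≤ = agree (≤-trans i≤ (≤-reflexive (cong suc (sym (+-suc r r)))))

  module _ {c : ℕ} (1≤c : 1 ≤ c) (z : List ℕ) (desc : Descending n z) where
    open PathGraph z desc

    private
      run′ : ℕ → Fin n → State A
      run′ = run A pathGraph (toℕ-idAssignment 1≤c)

    run-window : ∀ r {o w} → w ≗ nth z ∘ (_+ o) → (r + r) + o < length z →
                 ∀ u → toℕ u ≡ w r → run′ r u ≡ windowState r w
    run-window zero    w≗ _  u u≡ = cong (init A) u≡
    run-window (suc r) {o} {w} w≗ span< u u≡ =
      cong₂ (step A) (run-window r (window-suc z w≗) span₁< u u≡)
        (begin
          map (run′ r) (neighbours pathGraph u)
            ≡⟨ cong (map (run′ r)) (neighbours-window r w≗ centre< u≡) ⟩
          map (run′ r) (filterᵇ (isOneOf (w (suc (suc r))) (w r)) (allFin n))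
            ≡⟨ map-cong-local (All.tabulate (λ v∈ →
                 neighbour-state _ (proj₂ (∈-filter⁻ (T? ∘ isOneOf _ _) {xs = allFin n} v∈)))) ⟩
          neighbourStates (w (suc (suc r))) (w r) (windowState r (w ∘ suc ∘ suc)) (windowState r w) ∎)
      where
      open ≡-Reasoning
      span₂< : (r + r) + suc (suc o) < length z
      span₂< = subst (_< length z) (regroup r o) span<
        where
        regroup : ∀ r o → (suc r + suc r) + o ≡ (r + r) + suc (suc o)
        regroup = solve-∀
      span₁< : (r + r) + suc o < length z
      span₁< = <-trans (+-monoʳ-< (r + r) (n<1+n _)) span₂<
      span₀< : (r + r) + o < length z
      span₀< = <-trans (+-monoʳ-< (r + r) (n<1+n _)) span₁<
      centre< : suc (suc r) + o < length z
      centre< = ≤-<-trans (+-monoˡ-≤ o (s≤s (m≤n+m (suc r) r))) span<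
      neighbour-state : ∀ v → Bool.T (isOneOf (w (suc (suc r))) (w r) v) →
                        run′ r v ≡ (if toℕ v ≡ᵇ w (suc (suc r)) then windowState r (w ∘ suc ∘ suc) else windowState r w)
      neighbour-state v one with toℕ v ≡ᵇ w (suc (suc r)) in v≡
      ... | true  = run-window r (window-suc z (window-suc z w≗)) span₂< v (≡ᵇ-sound v≡)
      ... | false = run-window r w≗ span₀< v (≡ᵇ⇒≡ _ _ one)

lookup-injective : ∀ {A : Set} {xs : List A} → Unique xs → ∀ i j → lookup xs i ≡ lookup xs j → i ≡ j
lookup-injective (_ ∷ _)  Fin.zero    Fin.zero    _  = refl
lookup-injective (x∉ ∷ _) Fin.zero    (Fin.suc j) eq = ⊥-elim (All.lookup x∉ (∈-lookup j) eq)
lookup-injective (x∉ ∷ _) (Fin.suc i) Fin.zero    eq = ⊥-elim (All.lookup x∉ (∈-lookup i) (sym eq))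
lookup-injective (_ ∷ un) (Fin.suc i) (Fin.suc j) eq = cong Fin.suc (lookup-injective un i j eq)

Unique-⊆⇒length-≤ : ∀ {A : Set} {xs ys : List A} → Unique xs → (∀ {x} → x ∈ xs → x ∈ ys) →
                    length xs ≤ length ys
Unique-⊆⇒length-≤ {xs = xs} {ys} un xs⊆ys = injective⇒≤ {f = position} position-injective
  where
  position : Fin (length xs) → Fin (length ys)
  position i = index (xs⊆ys (∈-lookup i))
  position-injective : ∀ {i j} → position i ≡ position j → i ≡ j
  position-injective {i} {j} eq = lookup-injective un i j (begin
    lookup xs i             ≡⟨ lookup-index (xs⊆ys (∈-lookup i)) ⟩
    lookup ys (position i)  ≡⟨ cong (lookup ys) eq ⟩
    lookup ys (position j)  ≡⟨ lookup-index (xs⊆ys (∈-lookup j)) ⟨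
    lookup xs j             ∎)
    where open ≡-Reasoning

lowerEnd⇒just : ∀ {i o} → Bool.T (lowerEnd i o) → ∃ λ x → o ≡ just x
lowerEnd⇒just {o = just x} _ = x , refl

positive-factorʳ : ∀ {a b c} → 0 < a → a ≤ b * c → 0 < c
positive-factorʳ         {c = suc _} _   _  = s≤s z≤n
positive-factorʳ {b = b} {c = zero}  0<a a≤ = case ≤-trans 0<a (≤-trans a≤ (≤-reflexive (*-zeroʳ b))) of λ ()

module Outputs {n c T : ℕ} {A : Algorithm} {G : Graph n} {I : IdAssignment n c} where

  counted : Fin n → Bool
  counted u = lowerEnd (ident I u) (out A G I T u)

  counted⇒matched : ∀ {u} → u ∈ filterᵇ counted (allFin n) → ∃ λ x → out A G I T u ≡ just x
  counted⇒matched u∈ = lowerEnd⇒just (proj₂ (∈-filter⁻ (T? ∘ counted) {xs = allFin n} u∈))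

  outputSize>0⇒matched : 0 < outputSize A G I T → ∃ λ u → ∃ λ x → out A G I T u ≡ just x
  outputSize>0⇒matched _ with filterᵇ counted (allFin n) in counted≡
  ... | u ∷ _ = u , counted⇒matched (subst (u ∈_) (sym counted≡) (here refl))

  outputSize+unmatched≤ : OutputIsMatching A G I T → (U : List (Fin n)) (Z : List ℕ) → Unique U →
                          All (λ u → out A G I T u ≡ nothing) U → All (λ u → ident I u ∈ Z) U →
                          (∀ {u v} → Adj G u v → ident I u ∈ Z) →
                          outputSize A G I T + length U ≤ length Z
  outputSize+unmatched≤ isMatching U Z uniqueU unmatchedU U⊆Z edges⊆Z = begin
    length L + length U             ≡⟨ length-++ L ⟨
    length (L ++ U)                 ≡⟨ length-map (ident I) (L ++ U) ⟨
    length (map (ident I) (L ++ U)) ≤⟨ Unique-⊆⇒length-≤ unique ids⊆Z ⟩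
    length Z                        ∎
    where
    open ≤-Reasoning
    L : List (Fin n)
    L = filterᵇ counted (allFin n)
    disjoint : ∀ {u} → ¬ (u ∈ L × u ∈ U)
    disjoint (u∈L , u∈U) with counted⇒matched u∈L
    ... | _ , matched = case trans (sym matched) (All.lookup unmatchedU u∈U) of λ ()
    unique : Unique (map (ident I) (L ++ U))
    unique = Unique.map⁺ (injective I _ _)
               (Unique.++⁺ (Unique.filter⁺ (T? ∘ counted) (Unique.allFin⁺ n)) uniqueU disjoint)
    ids⊆Z : ∀ {x} → x ∈ map (ident I) (L ++ U) → x ∈ Z
    ids⊆Z x∈ with ∈-map⁻ (ident I) x∈
    ... | u , u∈ , refl with ∈-++⁻ L u∈
    ... | inj₂ u∈U = All.lookup U⊆Z u∈U
    ... | inj₁ u∈L with counted⇒matched u∈L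
    ... | x , matched = edges⊆Z (proj₁ (proj₂ (isMatching u x matched)))

module ZeroRounds {n c : ℕ} (1≤c : 1 ≤ c) (A : Algorithm) {p q : ℕ} (1≤q : 1 ≤ q)
                  (approx : ApproxMatchingAlgorithm c n p q 0 A) where

  -- On the path with identifiers b + 1 and 0 the vertex with identifier 0 is matched to b + 1.
  vertex0-output : ∀ b → suc b < n → output A (init A 0) ≡ just (suc b)
  vertex0-output b b< = mate-of-0 (outputSize>0⇒matched some-counted)
    where
    z : List ℕ
    z = suc b ∷ 0 ∷ []
    open PathGraph {n} z (b< , s≤s z≤n , tt)
    I : IdAssignment n c
    I = toℕ-idAssignment 1≤c
    open Outputs {n} {c} {0} {A} {pathGraph} {I}
    hi lo : Fin n
    hi = fromℕ< b<
    lo = fromℕ< (<-trans (s≤s z≤n) b<)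
    edge : List (Fin n × Fin n)
    edge = (hi , lo) ∷ []
    edge-isMatching : IsMatching pathGraph edge
    edge-isMatching =
      adjacent-consecutive {u = hi} {lo} (s≤s (s≤s z≤n)) (toℕ-fromℕ< b<) (toℕ-fromℕ< _) ∷ [] ,
      ((λ hi≡lo → case trans (sym (toℕ-fromℕ< b<)) (trans (cong toℕ hi≡lo) (toℕ-fromℕ< _)) of λ ()) ∷ []) ∷ [] ∷ []
    some-counted : 0 < outputSize A pathGraph I 0
    some-counted = positive-factorʳ {b = p} (subst (0 <_) (sym (*-identityʳ q)) 1≤q)
                     (proj₂ (approx pathGraph I) edge edge-isMatching)
    mate-of-0 : (∃ λ u → ∃ λ x → out A pathGraph I 0 u ≡ just x) → output A (init A 0) ≡ just (suc b)
    mate-of-0 (u , x , u↦x) with proj₁ (approx pathGraph I) u x u↦x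
    ... | v , uv , v≡x , v↦u with consecutive z (toℕ u) (toℕ v) in u→v
    ... | true with consecutive-pair⇒ u→v
    ...   | u≡ , v≡ = trans (subst (λ i → output A (init A i) ≡ just (toℕ u)) v≡ v↦u) (cong just u≡)
    mate-of-0 (u , x , u↦x) | v , uv , v≡x , v↦u | false with consecutive-pair⇒ uv
    ...   | v≡ , u≡ = trans (subst (λ i → output A (init A i) ≡ just x) u≡ u↦x) (cong just (trans (sym v≡x) v≡))

  zeroRounds-impossible : 3 ≤ n → ⊥
  zeroRounds-impossible 3≤n =
    case trans (sym (vertex0-output 0 (<-trans (s≤s (s≤s z≤n)) 3≤n))) (vertex0-output 1 3≤n) of λ ()

-- From a matching algorithm to a colouring of the shift graph

-- How an output o relates to the identifiers a of the next and b of the previous vertex on the path.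
data MateView (a b : ℕ) (o : Maybe ℕ) : Fin 4 → Set where
  unmatched : o ≡ nothing → MateView a b o (# 0)
  ahead     : o ≡ just a  → MateView a b o (# 1)
  behind    : o ≡ just b  → MateView a b o (# 2)
  elsewhere : ∀ {x} → o ≡ just x → x ≢ a → x ≢ b → MateView a b o (# 3)

mateView : ∀ o a b → ∃ (MateView a b o)
mateView nothing  a b = _ , unmatched refl
mateView (just x) a b with x ≟ a | x ≟ b
... | yes refl | _        = _ , ahead refl
... | no _     | yes refl = _ , behind refl
... | no x≢a   | no x≢b   = _ , elsewhere refl x≢a x≢b

mateCode : Maybe ℕ → ℕ → ℕ → Fin 4
mateCode o a b = proj₁ (mateView o a b)

MateView-unmatched : ∀ {a b o} → MateView a b o (# 0) → o ≡ nothing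
MateView-unmatched (unmatched o≡) = o≡

-- Windows of K = 2T + 2 + S identifiers; the path has K + 1 = 2H vertices, and when S + 1 of them
-- are unmatched at most D = 2T + 2 edges are counted, so the gap p·D < q·H is contradictory.
module LowerBound {n c : ℕ} (1≤c : 1 ≤ c) (A : Algorithm) (T h : ℕ) where
  open Locality {n} A

  S H K : ℕ
  S = suc (h + h)
  H = suc (suc (T + h))
  K = suc (T + h) + H

  K≡ : K ≡ suc (suc (T + T)) + S
  K≡ = span T h
    where
    span : ∀ T h → suc (T + h) + suc (suc (T + h)) ≡ suc (suc (T + T)) + suc (h + h)
    span = solve-∀

  T≤ : T ≤ suc (suc (T + T))
  T≤ = m≤n⇒m≤1+n (m≤n⇒m≤1+n (m≤m+n T T))

  1+T≤ : suc T ≤ suc (suc (T + T))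
  1+T≤ = m≤n⇒m≤1+n (s≤s (m≤m+n T T))

  2+T≤ : suc (suc T) ≤ suc (suc (T + T))
  2+T≤ = s≤s (s≤s (m≤m+n T T))

  windowCode : (ℕ → ℕ) → Fin 4
  windowCode w = mateCode (output A (windowState T (w ∘ suc))) (w (suc (suc T))) (w T)

  windowCode-cong : ∀ {w w′} → (∀ {i} → i ≤ suc (suc (T + T)) → w i ≡ w′ i) → windowCode w ≡ windowCode w′
  windowCode-cong agree =
    cong₂ (λ s ab → mateCode (output A s) (proj₁ ab) (proj₂ ab))
      (windowState-cong T (λ i≤ → agree (m≤n⇒m≤1+n (s≤s i≤))))
      (cong₂ _,_ (agree 2+T≤) (agree T≤))

  windowCodes : List ℕ → Fin S → Fin 4
  windowCodes xs j = windowCode (λ i → nth xs (i + toℕ j))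

  colour : List ℕ → Fin (4 ^ S)
  colour xs = funToFin (windowCodes xs)

  module _ {p q : ℕ} (approx : ApproxMatchingAlgorithm c n p q T A)
           (gap : p * (suc T + suc T) < q * H) where

    module OnPath (z : List ℕ) (len : length z ≡ suc K) (desc : Descending n z) where
      open PathGraph z desc
      I : IdAssignment n c
      I = toℕ-idAssignment 1≤c
      open Outputs {n} {c} {T} {A} {pathGraph} {I}

      isMatching : OutputIsMatching A pathGraph I T
      isMatching = proj₁ (approx pathGraph I)

      code : ℕ → Fin 4
      code j = windowCode (λ i → nth z (i + j))

      Uniform : Fin 4 → Set
      Uniform κ = ∀ {j} → j ≤ S → ∀ u → toℕ u ≡ nth z (suc T + j) →
                  MateView (nth z (suc (suc T) + j)) (nth z (T + j)) (out A pathGraph I T u) κ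

      in-range : ∀ {i j} → i ≤ suc (suc (T + T)) → j ≤ S → i + j < length z
      in-range i≤ j≤ = ≤-<-trans (+-mono-≤ i≤ j≤) (subst (_< length z) K≡ (subst (K <_) (sym len) (n<1+n K)))

      positions-distinct : ∀ {i j} → i < j → j < length z → nth z i ≢ nth z j
      positions-distinct i<j j< eq = <-irrefl (sym eq) (nth-descending z desc i<j j<)

      0<n : 0 < n
      0<n = ≤-<-trans z≤n (All.lookup (Descending⇒All< z desc) (nth-∈ z (in-range {0} {0} z≤n z≤n)))

      vertex : ℕ → Fin n
      vertex k = fromℕ< ([ (λ k<n → k<n) , (λ nth≡0 → subst (_< n) (sym nth≡0) 0<n) ]′ (nth-<⊎≡0 z desc k))

      toℕ-vertex : ∀ k → toℕ (vertex k) ≡ nth z k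
      toℕ-vertex k = toℕ-fromℕ< _

      vertex-distinct : ∀ {i j} → i < j → j < length z → vertex i ≢ vertex j
      vertex-distinct i<j j< eq =
        positions-distinct i<j j< (trans (sym (toℕ-vertex _)) (trans (cong toℕ eq) (toℕ-vertex _)))

      code-view : ∀ {j} → j ≤ S → ∀ u → toℕ u ≡ nth z (suc T + j) →
                  MateView (nth z (suc (suc T) + j)) (nth z (T + j)) (out A pathGraph I T u) (code j)
      code-view {j} j≤ u u≡ =
        subst (λ s → MateView _ _ (output A s) (code j))
          (sym (run-window 1≤c z desc T (window-suc z (λ _ → refl)) centre< u u≡))
          (proj₂ (mateView _ _ _))
        where
        centre< : (T + T) + suc j < length z
        centre< = subst (_< length z) (sym (+-suc (T + T) j)) (in-range (m≤n⇒m≤1+n ≤-refl) j≤)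

      codes-shift : colour (drop 1 z) ≡ colour (dropLast z) → ∀ (j : Fin S) → code (suc (toℕ j)) ≡ code (toℕ j)
      codes-shift colours≡ j = begin
        windowCode (λ i → nth z (i + suc (toℕ j)))
          ≡⟨ windowCode-cong (λ {i} _ → trans (cong (nth z) (+-suc i (toℕ j))) (sym (nth-drop1 z _))) ⟩
        windowCodes (drop 1 z) j
          ≡⟨ funToFin-injective {f = windowCodes (drop 1 z)} {windowCodes (dropLast z)} colours≡ j ⟩
        windowCodes (dropLast z) j
          ≡⟨ windowCode-cong (λ {i} i≤ →
               nth-dropLast z (subst (_< length z) (+-suc i (toℕ j)) (in-range i≤ (toℕ<n j)))) ⟩
        code (toℕ j) ∎
        where open ≡-Reasoning

      codes-uniform : colour (drop 1 z) ≡ colour (dropLast z) → ∀ j → j ≤ S → code j ≡ code 0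
      codes-uniform colours≡ zero    _  = refl
      codes-uniform colours≡ (suc j) j< =
        trans (subst (λ k → code (suc k) ≡ code k) (toℕ-fromℕ< j<) (codes-shift colours≡ (fromℕ< j<)))
              (codes-uniform colours≡ j (<⇒≤ j<))

      uniform-view : colour (drop 1 z) ≡ colour (dropLast z) → Uniform (code 0)
      uniform-view colours≡ j≤ u u≡ = subst (MateView _ _ _) (codes-uniform colours≡ _ j≤) (code-view j≤ u u≡)

      perfectMatching : IsMatching pathGraph (pairs vertex H)
      perfectMatching =
        pairs-All vertex H (λ k< → adjacent-consecutive (subst (_ <_) (sym len) k<) (toℕ-vertex _) (toℕ-vertex _)) ,
        subst Unique (sym (endpoints-pairs vertex H))
          (Unique.applyUpTo⁺₁ vertex (H + H) (λ i<j j< → vertex-distinct i<j (subst (_ <_) (sym len) j<)))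

      unmatched-block⇒⊥ : (∀ {j} → j ≤ S → out A pathGraph I T (vertex (suc T + j)) ≡ nothing) → ⊥
      unmatched-block⇒⊥ all-unmatched = <⇒≱ gap (begin
        q * H                           ≡⟨ cong (q *_) (length-pairs vertex H) ⟨
        q * length (pairs vertex H)     ≤⟨ proj₂ (approx pathGraph I) _ perfectMatching ⟩
        p * outputSize A pathGraph I T  ≤⟨ *-monoʳ-≤ p (+-cancelʳ-≤ (suc S) _ _ counted+block≤) ⟩
        p * (suc T + suc T)             ∎)
        where
        open ≤-Reasoning
        centre : ℕ → Fin n
        centre j = vertex (suc T + j)
        block< : ∀ {j} → j < suc S → suc T + j < length z
        block< j< = in-range 1+T≤ (≤-pred j<)
        counted+block≤ : outputSize A pathGraph I T + suc S ≤ (suc T + suc T) + suc S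
        counted+block≤ = begin
          outputSize A pathGraph I T + suc S
            ≡⟨ cong (outputSize A pathGraph I T +_) (length-applyUpTo centre (suc S)) ⟨
          outputSize A pathGraph I T + length (applyUpTo centre (suc S))
            ≤⟨ outputSize+unmatched≤ isMatching (applyUpTo centre (suc S)) z
                 (Unique.applyUpTo⁺₁ centre (suc S) (λ i<j j< → vertex-distinct (+-monoʳ-< (suc T) i<j) (block< j<)))
                 (AllP.applyUpTo⁺₁ centre (suc S) (all-unmatched ∘ ≤-pred))
                 (AllP.applyUpTo⁺₁ centre (suc S) (λ j< → subst (_∈ z) (sym (toℕ-vertex _)) (nth-∈ z (block< j<))))
                 adjacent⇒∈ ⟩
          length z
            ≡⟨ len ⟩
          suc K
            ≡⟨ regroup T h ⟩
          (suc T + suc T) + suc S ∎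
          where
          regroup : ∀ T h → suc (suc (T + h) + suc (suc (T + h))) ≡ (suc T + suc T) + suc (suc (h + h))
          regroup = solve-∀

      ahead⇒⊥ : Uniform (# 1) → ⊥
      ahead⇒⊥ view with view z≤n (vertex (suc T + 0)) (toℕ-vertex _)
      ... | ahead u₀↦ with isMatching _ _ u₀↦
      ... | v , _ , v≡ , v↦u₀ with view (s≤s z≤n) v (trans v≡ (cong (nth z) (sym (+-suc (suc T) 0))))
      ... | ahead v↦ =
        positions-distinct (+-mono-< (n<1+n (suc T)) (s≤s z≤n)) (in-range 2+T≤ (s≤s z≤n))
          (trans (sym (toℕ-vertex _)) (just-injective (trans (sym v↦u₀) v↦)))

      behind⇒⊥ : Uniform (# 2) → ⊥
      behind⇒⊥ view with view (s≤s z≤n) (vertex (suc T + 1)) (toℕ-vertex _)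
      ... | behind u₁↦ with isMatching _ _ u₁↦
      ... | v , _ , v≡ , v↦u₁ with view z≤n v (trans v≡ (cong (nth z) (+-suc T 0)))
      ... | behind v↦ =
        positions-distinct (+-mono-< (n<1+n T) (s≤s z≤n)) (in-range 1+T≤ (s≤s z≤n))
          (sym (trans (sym (toℕ-vertex _)) (just-injective (trans (sym v↦u₁) v↦))))

      elsewhere⇒⊥ : Uniform (# 3) → ⊥
      elsewhere⇒⊥ view with view z≤n (vertex (suc T + 0)) (toℕ-vertex _)
      ... | elsewhere u₀↦x x≢a x≢b with isMatching _ _ u₀↦x
      ... | v , u₀v , v≡x , _
        with isOneOf-sound (trans (sym (adjacent-window T {0} {λ i → nth z (i + 0)} (λ _ → refl)
                                          (in-range 2+T≤ z≤n) (toℕ-vertex _) v)) u₀v)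
      ... | inj₁ v≡a = x≢a (trans (sym v≡x) v≡a)
      ... | inj₂ v≡b = x≢b (trans (sym v≡x) v≡b)

      uniform⇒⊥ : ∀ κ → Uniform κ → ⊥
      uniform⇒⊥ κ view with view z≤n (vertex (suc T + 0)) (toℕ-vertex _)
      ... | unmatched _     = unmatched-block⇒⊥ (λ j≤ → MateView-unmatched (view j≤ _ (toℕ-vertex _)))
      ... | ahead _         = ahead⇒⊥ view
      ... | behind _        = behind⇒⊥ view
      ... | elsewhere _ _ _ = elsewhere⇒⊥ view

    colour-isShiftColouring : IsShiftColouring n K colour
    colour-isShiftColouring z len desc colours≡ =
      OnPath.uniform⇒⊥ z len desc _ (OnPath.uniform-view z len desc colours≡)

    logStar-≤ : logStar n ≤ K + 2 * S
    logStar-≤ = logStar-tower (suc (T + h + H)) (2 * S) n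
      (subst (n ≤_) (trans (cong (tower (T + h + H)) (^-*-assoc 2 2 S)) (tower-2^ (T + h + H) (2 * S)))
        (IsShiftColouring⇒≤tower (T + h + H) colour colour-isShiftColouring))

quotient-bracket : ∀ p q .{{_ : NonZero q}} → p < q * suc (p / q) × q * suc (p / q) ≤ q + p
quotient-bracket p q =
  (begin-strict
    p                 ≡⟨ m≡m%n+[m/n]*n p q ⟩
    p % q + p / q * q <⟨ +-monoˡ-< (p / q * q) (m%n<n p q) ⟩
    q + p / q * q     ≡⟨ unfold ⟩
    q * suc (p / q)   ∎) ,
  (begin
    q * suc (p / q)   ≡⟨ unfold ⟨
    q + p / q * q     ≤⟨ +-monoʳ-≤ q (m/n*n≤m p q) ⟩
    q + p             ∎)
  where
  open ≤-Reasoning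
  unfold : q + p / q * q ≡ q * suc (p / q)
  unfold = trans (cong (q +_) (*-comm (p / q) q)) (sym (*-suc q (p / q)))

-- h = (⌊p/q⌋ + 1)·D makes the gap p·D < q·h hold while keeping q·h ≤ 2p·D.
rounds-lower-bound : ∀ {c n p q t} (A : Algorithm) → 1 ≤ c → 1 ≤ q → q ≤ p →
                     ApproxMatchingAlgorithm c n p q (suc t) A → q * logStar n ≤ 55 * p * suc t
rounds-lower-bound {c} {n} {p} {q@(suc _)} {t} A 1≤c _ q≤p approx = begin
  q * logStar n                                        ≤⟨ *-monoʳ-≤ q (logStar-≤ {p} {q} approx gap) ⟩
  q * (K + 2 * S)                                      ≡⟨ expand q T h ⟩
  2 * (q * T) + 6 * (q * h) + 5 * q                    ≤⟨ +-mono-≤ (+-mono-≤ (*-monoʳ-≤ 2 (*-monoˡ-≤ T q≤p))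
                                                            (*-monoʳ-≤ 6 qh≤)) (*-monoʳ-≤ 5 (≤-trans q≤p (m≤m*n p T))) ⟩
  2 * (p * T) + 6 * ((p + p) * (4 * T)) + 5 * (p * T)  ≡⟨ collect p T ⟩
  55 * p * T                                           ∎
  where
  open ≤-Reasoning
  T D r h : ℕ
  T = suc t
  D = suc T + suc T
  r = suc (p / q)
  h = r * D
  open LowerBound {n} 1≤c A T h
  expand : ∀ q T h → q * ((suc (T + h) + suc (suc (T + h))) + 2 * suc (h + h)) ≡ 2 * (q * T) + 6 * (q * h) + 5 * q
  expand = solve-∀
  collect : ∀ p T → 2 * (p * T) + 6 * ((p + p) * (4 * T)) + 5 * (p * T) ≡ 55 * p * T
  collect = solve-∀
  D≤4T : D ≤ 4 * T
  D≤4T = ≤-trans (m≤m+n D (t + t)) (≤-reflexive (regroup t))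
    where
    regroup : ∀ t → suc (suc t) + suc (suc t) + (t + t) ≡ 4 * suc t
    regroup = solve-∀
  gap : p * D < q * H
  gap = begin-strict
    p * D      <⟨ *-monoˡ-< D (proj₁ (quotient-bracket p q)) ⟩
    q * r * D  ≡⟨ *-assoc q r D ⟩
    q * h      ≤⟨ *-monoʳ-≤ q (m≤n⇒m≤1+n (m≤n⇒m≤1+n (m≤n+m h T))) ⟩
    q * H      ∎
  qh≤ : q * h ≤ (p + p) * (4 * T)
  qh≤ = begin
    q * h              ≡⟨ *-assoc q r D ⟨
    q * r * D          ≤⟨ *-mono-≤ (≤-trans (proj₂ (quotient-bracket p q)) (+-monoˡ-≤ p q≤p)) D≤4T ⟩
    (p + p) * (4 * T)  ∎

theorem7p2 : Σ ℕ λ a → Σ ℕ λ b → Σ ℕ λ n₀ →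
    (1 ≤ a) ×
    (∀ (c n p q T : ℕ) (A : Algorithm) →
       1 ≤ c → n₀ ≤ n → 1 ≤ q → q ≤ p →
       ApproxMatchingAlgorithm c n p q T A →
       a * q * logStar n ≤ b * p * T)
theorem7p2 = 1 , 55 , 3 , ≤-refl , bound
  where
  bound : ∀ (c n p q T : ℕ) (A : Algorithm) → 1 ≤ c → 3 ≤ n → 1 ≤ q → q ≤ p →
          ApproxMatchingAlgorithm c n p q T A → 1 * q * logStar n ≤ 55 * p * T
  bound c n p q zero    A 1≤c 3≤n 1≤q _   approx =
    ⊥-elim (ZeroRounds.zeroRounds-impossible 1≤c A {p} {q} 1≤q approx 3≤n)
  bound c n p q (suc t) A 1≤c _   1≤q q≤p approx rewrite *-identityˡ q =
    rounds-lower-bound A 1≤c 1≤q q≤p approx
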